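{- In $ALFA_I$, the inverse of $R_{8i}$ holds: for all graphs $A,B,C$, if $A\vdash_{ALFA_I}\langle B\Rightarrow C\rangle$ then $AB\vdash_{ALFA_I}C$.
   Context: Graphs of $ALFA_I$: the empty graph $\emptyset$ and propositional letters are graphs; if $G,H$ are graphs then so are the juxtaposition $GH$, the cut $[G]$ ($G$ inside a solid closed curve), the implication graph $\langle G\Rightarrow H\rangle$ (a solid closed curve containing $G$ and a dotted closed curve containing $H$), and the disjunction graph $\langle G\vee H\rangle$ (a solid closed curve containing two semi-dotted closed curves, one containing $G$ and one containing $H$; $\langle G\vee H\rangle=\langle H\vee G\rangle$). Juxtaposition is associative and commutative with unit $\emptyset$; $[\,]$ is the empty cut. (Intended reading: juxtaposition = conjunction, $[G]$ = negation, $[\,]$ = falsum, $\langle G\Rightarrow H\rangle$ = implication, $\langle G\vee H\rangle$ = disjunction.) Rules are schemata with $A,B,C$ arbitrary (possibly empty) graphs, applied to the whole graph on the sheet. First-degree rules: $I_\vee: A\vdash\langle A\vee B\rangle$; $I_\neg: [A]\vdash\langle A\Rightarrow[\,]\rangle$; $R_2: AB\vdash A$; $E_\neg:\langle A\Rightarrow[\,]\rangle\vdash[A]$; $MP_i: A\langle A\Rightarrow B\rangle\vdash B$; $E_\bot: [\,]\vdash A$. Second-degree rules: $R_{8i}$: if $AB\vdash C$ then $A\vdash\langle B\Rightarrow C\rangle$; $R_0$: if $A\vdash B$ and $A\vdash C$ then $A\vdash BC$; $E_\vee$: if $A\vdash C$ and $B\vdash C$ then $\langle A\vee B\rangle\vdash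 C$. $\vdash_{ALFA_I}$ is the least transitive relation on graphs containing all instances of the first-degree rules and closed under the second-degree rules. -}

module Defs where

open import Data.Nat using (ℕ)

data Graph : Set where
  ∅     : Graph
  letter : ℕ → Graph
  _·_   : Graph → Graph → Graph
  cut   : Graph → Graph
  ⟨_⇒_⟩ : Graph → Graph → Graph
  ⟨_∨_⟩ : Graph → Graph → Graph

infixl 6 _·_

emptyCut : Graph
emptyCut = cut ∅

data _≈_ : Graph → Graph → Set where
  ≈-refl  : ∀ {G} → G ≈ G
  ≈-sym   : ∀ {G H} → G ≈ H → H ≈ G
  ≈-trans : ∀ {G H K} → G ≈ H → H ≈ K → G ≈ K
  ·-assoc : ∀ {G H K} → ((G · H) · K) ≈ (G · (H · K))
  ·-comm  : ∀ {G H} → (G · H) ≈ (H · G)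
  ·-unitˡ : ∀ {G} → (∅ · G) ≈ G
  ∨-comm  : ∀ {G H} → ⟨ G ∨ H ⟩ ≈ ⟨ H ∨ G ⟩
  ·-cong  : ∀ {G G' H H'} → G ≈ G' → H ≈ H' → (G · H) ≈ (G' · H')
  cut-cong : ∀ {G G'} → G ≈ G' → cut G ≈ cut G'
  ⇒-cong  : ∀ {G G' H H'} → G ≈ G' → H ≈ H' → ⟨ G ⇒ H ⟩ ≈ ⟨ G' ⇒ H' ⟩
  ∨-cong  : ∀ {G G' H H'} → G ≈ G' → H ≈ H' → ⟨ G ∨ H ⟩ ≈ ⟨ G' ∨ H' ⟩

-- Derivability in ALFA_I: least transitive relation containing the
-- first-degree rules and closed under the second-degree rules
-- (rules apply to graphs up to the identification _≈_).
data _⊢_ : Graph → Graph → Set where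
  conv   : ∀ {A A' B B'} → A ≈ A' → B ≈ B' → A ⊢ B → A' ⊢ B'
  ⊢-trans : ∀ {A B C} → A ⊢ B → B ⊢ C → A ⊢ C
  I∨   : ∀ {A B} → A ⊢ ⟨ A ∨ B ⟩
  I¬   : ∀ {A} → cut A ⊢ ⟨ A ⇒ emptyCut ⟩
  R2   : ∀ {A B} → (A · B) ⊢ A
  E¬   : ∀ {A} → ⟨ A ⇒ emptyCut ⟩ ⊢ cut A
  MPi  : ∀ {A B} → (A · ⟨ A ⇒ B ⟩) ⊢ B
  E⊥   : ∀ {A} → emptyCut ⊢ A
  R8i  : ∀ {A B C} → (A · B) ⊢ C → A ⊢ ⟨ B ⇒ C ⟩
  R0   : ∀ {A B C} → A ⊢ B → A ⊢ C → A ⊢ (B · C)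
  E∨   : ∀ {A B C} → A ⊢ C → B ⊢ C → ⟨ A ∨ B ⟩ ⊢ C

module Submission where

open import Defs

R2ʳ : ∀ {A B : Graph} → (A · B) ⊢ B
R2ʳ = conv ·-comm ≈-refl R2

mainTheorem7 : ∀ {A B C : Graph} → A ⊢ ⟨ B ⇒ C ⟩ → (A · B) ⊢ C
mainTheorem7 A⊢B⇒C = ⊢-trans (R0 R2ʳ (⊢-trans R2 A⊢B⇒C)) MPi
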